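{- Let $(S,\curlyvee)$ be a $\curlyvee$-algebra. A non-empty subset $I\subseteq S$ is a $\lesssim$-ideal if and only if it is a down-set under $\lesssim$ such that $i\curlyvee j\in I$ whenever $i,j\in I$.
   Context: A $\curlyvee$-algebra is an algebra $(S,\curlyvee)$ with a binary operation such that, setting $a\sqcup b=a\curlyvee(a\curlyvee b)$: $(S,\sqcup)$ is a left regular band (associative, $a\sqcup a=a$, $a\sqcup b\sqcup a=a\sqcup b$); $\curlyvee$ is commutative and idempotent; $(a\curlyvee b)\sqcup(a\sqcup b)=a\sqcup b$; $a\sqcup(b\curlyvee c)=(a\sqcup b)\curlyvee(a\sqcup c)$; and, writing $x\lesssim y$ iff $y\sqcup x=y$: if $d\lesssim a,b,c,a\curlyvee b,b\curlyvee c$ then $d\lesssim a\curlyvee c$. A $\lesssim$-ideal of $S$ is a non-empty subset $I$ that is a down-set under the quasiorder $\lesssim$ (if $x\lesssim i\in I$ then $x\in I$) and such that $i\sqcup j\in I$ whenever $i,j\in I$. -}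

module Defs where

open import Level using (Level) renaming (_⊔_ to _⊔ˡ_)
open import Data.Product using (Σ; ∃; _×_; _,_)
open import Relation.Binary.PropositionalEquality using (_≡_)

module _ {a : Level} {S : Set a} (_⋎_ : S → S → S) where

  _⊔ₛ_ : S → S → S
  x ⊔ₛ y = x ⋎ (x ⋎ y)

  _≲_ : S → S → Set a
  x ≲ y = y ⊔ₛ x ≡ y

record IsCurlyveeAlgebra {a : Level} {S : Set a} (_⋎_ : S → S → S) : Set a where
  private
    _⊔_ : S → S → S
    _⊔_ = _⊔ₛ_ _⋎_
    _≲'_ : S → S → Set a
    _≲'_ = _≲_ _⋎_
  field
    -- (S, ⊔) is a left regular band
    ⊔-assoc  : ∀ x y z → (x ⊔ y) ⊔ z ≡ x ⊔ (y ⊔ z)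
    ⊔-idem   : ∀ x → x ⊔ x ≡ x
    ⊔-leftRegular : ∀ x y → (x ⊔ y) ⊔ x ≡ x ⊔ y
    ⋎-comm   : ∀ x y → x ⋎ y ≡ y ⋎ x
    ⋎-idem   : ∀ x → x ⋎ x ≡ x
    ⋎-⊔-absorb : ∀ x y → (x ⋎ y) ⊔ (x ⊔ y) ≡ x ⊔ y
    ⊔-distrib-⋎ : ∀ x y z → x ⊔ (y ⋎ z) ≡ (x ⊔ y) ⋎ (x ⊔ z)
    ≲-⋎-condition : ∀ d x y z → d ≲' x → d ≲' y → d ≲' z →
                    d ≲' (x ⋎ y) → d ≲' (y ⋎ z) → d ≲' (x ⋎ z)

module _ {a ℓ : Level} {S : Set a} (_⋎_ : S → S → S) (I : S → Set ℓ) where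

  NonEmpty : Set (a ⊔ˡ ℓ)
  NonEmpty = ∃ λ i → I i

  IsDownSet : Set (a ⊔ˡ ℓ)
  IsDownSet = ∀ x i → _≲_ _⋎_ x i → I i → I x

  Is≲Ideal : Set (a ⊔ˡ ℓ)
  Is≲Ideal = NonEmpty × IsDownSet × (∀ i j → I i → I j → I (_⊔ₛ_ _⋎_ i j))

{-# OPTIONS --safe #-}
module Submission where

open import Defs
open import Level using (Level)
open import Data.Product using (_×_; _,_)
open import Function.Bundles using (_⇔_; mk⇔)
open import Relation.Binary.PropositionalEquality using (_≡_; trans; cong; cong₂; module ≡-Reasoning)

-- Since i ⊔ j = i ⋎ (i ⋎ j), closure under ⋎ gives closure under ⊔ directly.
-- Conversely i ⋎ j ≲ i ⊔ j, so a down-set closed under ⊔ is closed under ⋎.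

module _ {a : Level} {S : Set a} {_⋎_ : S → S → S} (alg : IsCurlyveeAlgebra _⋎_) where

  open IsCurlyveeAlgebra alg

  private
    _⊔_ : S → S → S
    _⊔_ = _⊔ₛ_ _⋎_

  ⊔-idemʳ : ∀ x y → (x ⊔ y) ⊔ y ≡ x ⊔ y
  ⊔-idemʳ x y = trans (⊔-assoc x y y) (cong (x ⊔_) (⊔-idem y))

  ⋎≲⊔ : ∀ x y → _≲_ _⋎_ (x ⋎ y) (x ⊔ y)
  ⋎≲⊔ x y = begin
    (x ⊔ y) ⊔ (x ⋎ y)              ≡⟨ ⊔-distrib-⋎ (x ⊔ y) x y ⟩
    ((x ⊔ y) ⊔ x) ⋎ ((x ⊔ y) ⊔ y)  ≡⟨ cong₂ _⋎_ (⊔-leftRegular x y) (⊔-idemʳ x y) ⟩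
    (x ⊔ y) ⋎ (x ⊔ y)              ≡⟨ ⋎-idem (x ⊔ y) ⟩
    x ⊔ y                          ∎
    where open ≡-Reasoning

  module _ {ℓ : Level} {I : S → Set ℓ} where

    ⋎-closed⇒⊔-closed : (∀ i j → I i → I j → I (i ⋎ j)) →
                        ∀ i j → I i → I j → I (i ⊔ j)
    ⋎-closed⇒⊔-closed closed i j Ii Ij = closed i (i ⋎ j) Ii (closed i j Ii Ij)

    ⊔-closed-downSet⇒⋎-closed : IsDownSet _⋎_ I → (∀ i j → I i → I j → I (i ⊔ j)) →
                                ∀ i j → I i → I j → I (i ⋎ j)
    ⊔-closed-downSet⇒⋎-closed down closed i j Ii Ij =
      down (i ⋎ j) (i ⊔ j) (⋎≲⊔ i j) (closed i j Ii Ij)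

proposition4p5 : ∀ {a ℓ : Level} {S : Set a} (_⋎_ : S → S → S) →
    IsCurlyveeAlgebra _⋎_ →
    (I : S → Set ℓ) → NonEmpty _⋎_ I →
    Is≲Ideal _⋎_ I ⇔ (IsDownSet _⋎_ I × (∀ i j → I i → I j → I (i ⋎ j)))
proposition4p5 _⋎_ alg I nonEmpty = mk⇔
  (λ (_ , down , ⊔-closed) → down , ⊔-closed-downSet⇒⋎-closed alg down ⊔-closed)
  (λ (down , ⋎-closed) → nonEmpty , down , ⋎-closed⇒⊔-closed alg ⋎-closed)
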